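{- Let $G=(V,E)$ be a finite simple undirected graph and $0<\lambda_t<\lambda_{t+1}<1$. Let $x^t$ and $x^{t+1}$ be optimal solutions of the LambdaCC LP relaxation for parameters $\lambda_t$ and $\lambda_{t+1}$, respectively, and let $\delta=\frac{\lambda_{t+1}}{\lambda_t}\cdot\frac{1-\lambda_t}{1-\lambda_{t+1}}$. Then $x^t$ is a $\delta$-approximate solution of the LambdaCC LP relaxation for parameter $\lambda_{t+1}$, and $x^{t+1}$ is a $\delta$-approximate solution of the LambdaCC LP relaxation for parameter $\lambda_t$.
   Context: The LambdaCC LP relaxation with parameter $\lambda$ has variables $x_{ij}$ for unordered pairs $i<j$ of nodes and is: minimize $\sum_{(i,j)\in E}(1-\lambda)x_{ij}+\sum_{(i,j)\notin E,\,i<j}\lambda(1-x_{ij})$ subject to $x_{ij}\le x_{ik}+x_{jk}$ for all $i,j,k$ and $0\le x_{ij}\le1$. A feasible solution is a $\delta$-approximate solution at $\lambda$ if its objective value at $\lambda$ is at most $\delta$ times the optimal value at $\lambda$.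
   Formalization: The parameters $\lambda_t$ and $\lambda_{t+1}$ are rational, and the solutions $x^t$, $x^{t+1}$ and the feasible points they are compared with have rational entries. -}

module Defs where

open import Data.Nat using (ℕ; zero; suc)
open import Data.Fin using (Fin; zero; suc; toℕ)
open import Data.Nat.Base using (_<ᵇ_)
open import Data.Bool using (Bool; true; false; if_then_else_)
open import Data.Product using (_×_)
open import Data.Rational using (ℚ; 0ℚ; 1ℚ; _+_; _*_; _-_; _≤_; _÷_; _≟_; ≢-nonZero)
open import Relation.Binary.PropositionalEquality using (_≡_)
open import Relation.Nullary using (yes; no)

record SimpleGraph (n : ℕ) : Set where
  field
    adj   : Fin n → Fin n → Bool
    sym   : ∀ i j → adj i j ≡ adj j i
    irrfl : ∀ i → adj i i ≡ false
open SimpleGraph public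

sumFin : {n : ℕ} → (Fin n → ℚ) → ℚ
sumFin {zero}  f = 0ℚ
sumFin {suc n} f = f zero + sumFin (λ i → f (suc i))

-- An LP point: the values x i j are the variables x_{ij}; only entries with
-- toℕ i < toℕ j (unordered pairs i<j) are ever used.
LPPoint : ℕ → Set
LPPoint n = Fin n → Fin n → ℚ

-- x_{ij} for an arbitrary ordered pair, read through the unordered pair {i,j};
-- x_{ii} := 0 (so triangle constraints with repeated indices are trivial).
dist : {n : ℕ} → LPPoint n → Fin n → Fin n → ℚ
dist x i j =
  if toℕ i <ᵇ toℕ j then x i j
  else (if toℕ j <ᵇ toℕ i then x j i else 0ℚ)

Feasible : {n : ℕ} → LPPoint n → Set
Feasible {n} x =
  (∀ (i j k : Fin n) → dist x i j ≤ dist x i k + dist x j k)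
  × (∀ (i j : Fin n) → (toℕ i <ᵇ toℕ j) ≡ true → (0ℚ ≤ x i j × x i j ≤ 1ℚ))

objective : {n : ℕ} → SimpleGraph n → ℚ → LPPoint n → ℚ
objective G lam x =
  sumFin (λ i → sumFin (λ j →
    if toℕ i <ᵇ toℕ j
      then (if adj G i j then (1ℚ - lam) * x i j else lam * (1ℚ - x i j))
      else 0ℚ))

IsOptimal : {n : ℕ} → SimpleGraph n → ℚ → LPPoint n → Set
IsOptimal {n} G lam x =
  Feasible x × (∀ (y : LPPoint n) → Feasible y → objective G lam x ≤ objective G lam y)

-- x is a d-approximate solution at lam: feasible, with objective at most d times
-- the optimal value (= the infimum of the objective over feasible points).
IsApprox : {n : ℕ} → SimpleGraph n → ℚ → ℚ → LPPoint n → Set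
IsApprox {n} G d lam x =
  Feasible x × (∀ (y : LPPoint n) → Feasible y → objective G lam x ≤ d * objective G lam y)

-- Total division (q / 0 := 0); only used where the denominator is nonzero.
_÷'_ : ℚ → ℚ → ℚ
p ÷' q with q ≟ 0ℚ
... | yes _ = 0ℚ
... | no q≢0 = _÷_ p q {{≢-nonZero q≢0}}

delta : ℚ → ℚ → ℚ
delta lam lam' = (lam' ÷' lam) * ((1ℚ - lam) ÷' (1ℚ - lam'))

-- For a point x with coordinates in [0, 1], the objective at λ' is at most
-- r = λ'/λ times the objective at λ, termwise: edge terms have coefficient
-- 1 - λ' ≤ 1 - λ ≤ r (1 - λ) and non-edge terms λ' = r λ. Symmetrically the
-- objective at λ is at most s = (1 - λ)/(1 - λ') times the objective at λ'.
-- Chaining these comparisons through the optimality of x^t (resp. x^{t+1})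
-- bounds its objective at the other parameter by r s = δ times the objective
-- of any feasible point.
module Submission where

open import Defs hiding (sym)
open import Data.Nat using (ℕ; zero; suc)
open import Data.Nat.Base using (_<ᵇ_)
open import Data.Fin using (Fin; zero; suc; toℕ)
open import Data.Bool using (true; false; if_then_else_)
open import Data.Product using (_×_; _,_; swap)
open import Data.Rational
  using (ℚ; 0ℚ; 1ℚ; _<_; _≤_; _+_; _*_; _-_; -_; 1/_; _≟_; NonZero; ≢-nonZero; nonNegative; positive)
open import Data.Rational.Properties
open import Relation.Binary.PropositionalEquality using (_≡_; _≢_; ≢-sym; sym; cong; subst; module ≡-Reasoning)
open import Relation.Nullary using (yes; no; contradiction)

p≤q⇒0≤q-p : ∀ {p q} → p ≤ q → 0ℚ ≤ q - p
p≤q⇒0≤q-p {p} {q} p≤q = subst (_≤ q - p) (+-inverseʳ p) (+-monoˡ-≤ (- p) p≤q)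

p<q⇒0<q-p : ∀ {p q} → p < q → 0ℚ < q - p
p<q⇒0<q-p {p} {q} p<q = subst (_< q - p) (+-inverseʳ p) (+-monoˡ-< (- p) p<q)

-‿antimonoʳ-≤ : ∀ r {p q} → p ≤ q → r - q ≤ r - p
-‿antimonoʳ-≤ r p≤q = +-monoʳ-≤ r (neg-antimono-≤ p≤q)

p≤r*p : ∀ {p r} → 0ℚ ≤ p → 1ℚ ≤ r → p ≤ r * p
p≤r*p {p} {r} 0≤p 1≤r =
  subst (_≤ r * p) (*-identityˡ p) (*-monoʳ-≤-nonNeg p {{nonNegative 0≤p}} 1≤r)

÷'-*-cancel : ∀ p {q} → q ≢ 0ℚ → (p ÷' q) * q ≡ p
÷'-*-cancel p {q} q≢0 with q ≟ 0ℚ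
... | yes q≡0 = contradiction q≡0 q≢0
... | no q≢0′ = begin
  p * (1/ q) * q   ≡⟨ *-assoc p (1/ q) q ⟩
  p * (1/ q * q)   ≡⟨ cong (p *_) (*-inverseˡ q) ⟩
  p * 1ℚ           ≡⟨ *-identityʳ p ⟩
  p                ∎
  where
  open ≡-Reasoning
  instance
    q-nonZero : NonZero q
    q-nonZero = ≢-nonZero q≢0′

÷'-≥1 : ∀ {p q} → 0ℚ < q → q ≤ p → 1ℚ ≤ p ÷' q
÷'-≥1 {p} {q} 0<q q≤p = *-cancelʳ-≤-pos q {{positive 0<q}} (begin
  1ℚ * q       ≡⟨ *-identityˡ q ⟩
  q            ≤⟨ q≤p ⟩
  p            ≡⟨ sym (÷'-*-cancel p (≢-sym (<⇒≢ 0<q))) ⟩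
  (p ÷' q) * q ∎)
  where open ≤-Reasoning

ratio-dominates : ∀ {p q p′ q′} → 0ℚ < q → q ≤ p → 0ℚ ≤ q′ → p′ ≤ q′
                  → p ≤ (p ÷' q) * q × p′ ≤ (p ÷' q) * q′
ratio-dominates {p} 0<q q≤p 0≤q′ p′≤q′ =
  ≤-reflexive (sym (÷'-*-cancel p (≢-sym (<⇒≢ 0<q)))) ,
  ≤-trans p′≤q′ (p≤r*p 0≤q′ (÷'-≥1 0<q q≤p))

sumFin-≤-* : ∀ {n} c {f g : Fin n → ℚ} → (∀ i → f i ≤ c * g i) → sumFin f ≤ c * sumFin g
sumFin-≤-* {zero}  c         _     = ≤-reflexive (sym (*-zeroʳ c))
sumFin-≤-* {suc n} c {f} {g} f≤cg = begin
  f zero + sumFin (λ i → f (suc i))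
    ≤⟨ +-mono-≤ (f≤cg zero) (sumFin-≤-* c (λ i → f≤cg (suc i))) ⟩
  c * g zero + c * sumFin (λ i → g (suc i))
    ≡⟨ sym (*-distribˡ-+ c (g zero) (sumFin (λ i → g (suc i)))) ⟩
  c * sumFin g ∎
  where open ≤-Reasoning

InUnitCube : ∀ {n} → LPPoint n → Set
InUnitCube {n} x = ∀ (i j : Fin n) → (toℕ i <ᵇ toℕ j) ≡ true → 0ℚ ≤ x i j × x i j ≤ 1ℚ

-- objective G lam x unfolds definitionally to sumFin (λ i → sumFin (summand G lam x i)).
summand : ∀ {n} → SimpleGraph n → ℚ → LPPoint n → Fin n → Fin n → ℚ
summand G lam x i j =
  if toℕ i <ᵇ toℕ j
    then (if adj G i j then (1ℚ - lam) * x i j else lam * (1ℚ - x i j))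
    else 0ℚ

summand-≤-* : ∀ {n} (G : SimpleGraph n) a b c {x : LPPoint n} → InUnitCube x
              → a ≤ c * b × 1ℚ - a ≤ c * (1ℚ - b)
              → ∀ i j → summand G a x i j ≤ c * summand G b x i j
summand-≤-* G a b c {x} x∈cube (a≤cb , 1-a≤c[1-b]) i j with toℕ i <ᵇ toℕ j in i<j
... | false = ≤-reflexive (sym (*-zeroʳ c))
... | true with adj G i j | x∈cube i j i<j
...   | true  | 0≤x , _ = begin
  (1ℚ - a) * x i j       ≤⟨ *-monoʳ-≤-nonNeg (x i j) {{nonNegative 0≤x}} 1-a≤c[1-b] ⟩
  c * (1ℚ - b) * x i j   ≡⟨ *-assoc c (1ℚ - b) (x i j) ⟩
  c * ((1ℚ - b) * x i j) ∎
  where open ≤-Reasoning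
...   | false | _ , x≤1 = begin
  a * (1ℚ - x i j)       ≤⟨ *-monoʳ-≤-nonNeg (1ℚ - x i j) {{nonNegative (p≤q⇒0≤q-p x≤1)}} a≤cb ⟩
  c * b * (1ℚ - x i j)   ≡⟨ *-assoc c b (1ℚ - x i j) ⟩
  c * (b * (1ℚ - x i j)) ∎
  where open ≤-Reasoning

objective-≤-* : ∀ {n} (G : SimpleGraph n) a b c {x : LPPoint n} → InUnitCube x
                → a ≤ c * b × 1ℚ - a ≤ c * (1ℚ - b)
                → objective G a x ≤ c * objective G b x
objective-≤-* G a b c x∈cube coefficients≤ =
  sumFin-≤-* c (λ i → sumFin-≤-* c (summand-≤-* G a b c x∈cube coefficients≤ i))

optimal⇒approx : ∀ {n} (G : SimpleGraph n) a b c d {x : LPPoint n} → 0ℚ ≤ c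
                 → (∀ y → Feasible y → objective G a y ≤ c * objective G b y)
                 → (∀ y → Feasible y → objective G b y ≤ d * objective G a y)
                 → IsOptimal G b x → IsApprox G (c * d) a x
optimal⇒approx G a b c d {x} 0≤c a≤c·b b≤d·a (x-feasible , x-optimal) =
  x-feasible , bound
  where
  open ≤-Reasoning
  bound : ∀ y → Feasible y → objective G a x ≤ c * d * objective G a y
  bound y y-feasible = begin
    objective G a x           ≤⟨ a≤c·b x x-feasible ⟩
    c * objective G b x       ≤⟨ *-monoˡ-≤-nonNeg c {{nonNegative 0≤c}} (x-optimal y y-feasible) ⟩
    c * objective G b y       ≤⟨ *-monoˡ-≤-nonNeg c {{nonNegative 0≤c}} (b≤d·a y y-feasible) ⟩
    c * (d * objective G a y) ≡⟨ sym (*-assoc c d (objective G a y)) ⟩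
    c * d * objective G a y   ∎

lemma9 : (n : ℕ) (G : SimpleGraph n) (lt lt1 : ℚ)
         → 0ℚ < lt → lt < lt1 → lt1 < 1ℚ
         → (xt xt1 : LPPoint n)
         → IsOptimal G lt xt → IsOptimal G lt1 xt1
         → IsApprox G (delta lt lt1) lt1 xt × IsApprox G (delta lt lt1) lt xt1
lemma9 n G lt lt1 0<lt lt<lt1 lt1<1 xt xt1 xt-optimal xt1-optimal =
  optimal⇒approx G lt1 lt r s (nonNeg 0<lt lt≤lt1) lt1≤r·lt lt≤s·lt1 xt-optimal ,
  subst (λ d → IsApprox G d lt xt1) (*-comm s r)
    (optimal⇒approx G lt lt1 s r (nonNeg 0<1-lt1 1-lt1≤1-lt) lt≤s·lt1 lt1≤r·lt xt1-optimal)
  where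
  r s : ℚ
  r = lt1 ÷' lt
  s = (1ℚ - lt) ÷' (1ℚ - lt1)
  nonNeg : ∀ {p q} → 0ℚ < q → q ≤ p → 0ℚ ≤ p ÷' q
  nonNeg 0<q q≤p = ≤-trans (<⇒≤ (positive⁻¹ 1ℚ)) (÷'-≥1 0<q q≤p)
  lt≤lt1 : lt ≤ lt1
  lt≤lt1 = <⇒≤ lt<lt1
  0<1-lt1 : 0ℚ < 1ℚ - lt1
  0<1-lt1 = p<q⇒0<q-p lt1<1
  1-lt1≤1-lt : 1ℚ - lt1 ≤ 1ℚ - lt
  1-lt1≤1-lt = -‿antimonoʳ-≤ 1ℚ lt≤lt1
  lt1≤r·lt : ∀ y → Feasible y → objective G lt1 y ≤ r * objective G lt y
  lt1≤r·lt y (_ , y∈cube) = objective-≤-* G lt1 lt r y∈cube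
    (ratio-dominates 0<lt lt≤lt1 (<⇒≤ (<-≤-trans 0<1-lt1 1-lt1≤1-lt)) 1-lt1≤1-lt)
  lt≤s·lt1 : ∀ y → Feasible y → objective G lt y ≤ s * objective G lt1 y
  lt≤s·lt1 y (_ , y∈cube) = objective-≤-* G lt lt1 s y∈cube
    (swap (ratio-dominates 0<1-lt1 1-lt1≤1-lt (<⇒≤ (<-trans 0<lt lt<lt1)) lt≤lt1))
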